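{- Let $\gamma\ge0$ and $b\in[\gamma]$, and let $\pi:\mathbf{Free}(\{\prec_a,\succ_a:a\in[\gamma]\})\to\mathsf{Dendr}_\gamma$ be the canonical surjection. Then $\odot_b:=\pi(\prec_b+\succ_b)$ is associative in $\mathsf{Dendr}_\gamma$, i.e. $\odot_b\circ_1\odot_b=\odot_b\circ_2\odot_b$.
   Context: All operads are nonsymmetric operads over a field $\mathbb{K}$ of characteristic zero; $\mathbf{Free}(G)$ is the free nonsymmetric operad on a set $G$ of binary generators, and an operad with presentation $(G,R)$, $R\subseteq\mathbf{Free}(G)(3)$, is $\mathbf{Free}(G)/\langle R\rangle$. $[n]=\{1,\dots,n\}$, $a\downarrow a'=\min(a,a')$. The operad $\mathsf{Dendr}_\gamma$ is generated by binary elements $\prec_a,\succ_a$, $a\in[\gamma]$, with space of relations spanned by, for all $a,a'\in[\gamma]$: $\prec_a\circ_1\succ_{a'}-\succ_{a'}\circ_2\prec_a$; $\prec_a\circ_1\prec_{a'}-\prec_{a\downarrow a'}\circ_2\prec_a-\prec_{a\downarrow a'}\circ_2\succ_{a'}$; $\succ_{a\downarrow a'}\circ_1\prec_{a'}+\succ_{a\downarrow a'}\circ_1\succ_a-\succ_a\circ_2\succ_{a'}$. -}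

module Defs where

open import Level using (Level; suc; _⊔_)
open import Data.Bool using (Bool; true; false; if_then_else_)
open import Data.Nat as ℕ using (ℕ; _≤ᵇ_)
open import Data.Fin as Fin using (Fin; toℕ)
import Data.Bool
import Data.Fin
import Relation.Nullary
open import Data.Product using (_×_; _,_; Σ; ∃)
open import Data.List using (List; []; _∷_)
open import Algebra.Bundles using (CommutativeRing)
open import Relation.Nullary using (¬_)
open import Relation.Binary.PropositionalEquality using (_≡_)

natToK : ∀ {c ℓ} (R : CommutativeRing c ℓ) → ℕ → CommutativeRing.Carrier R
natToK R ℕ.zero    = CommutativeRing.0# R
natToK R (ℕ.suc n) = CommutativeRing._+_ R (CommutativeRing.1# R) (natToK R n)

record CharZeroField (c ℓ : Level) : Set (suc (c ⊔ ℓ)) where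
  field
    commutativeRing : CommutativeRing c ℓ
  open CommutativeRing commutativeRing public
  field
    0≉1      : ¬ (0# ≈ 1#)
    inverse  : ∀ x → ¬ (x ≈ 0#) → ∃ λ y → x * y ≈ 1#
    charZero : ∀ n → natToK commutativeRing n ≈ 0# → n ≡ ℕ.zero

Gen : ℕ → Set
Gen γ = Bool × Fin γ

≺ : ∀ {γ} → Fin γ → Gen γ
≺ a = false , a

≻ : ∀ {γ} → Fin γ → Gen γ
≻ a = true , a

_↓_ : ∀ {γ} → Fin γ → Fin γ → Fin γ
a ↓ a' = if toℕ a ≤ᵇ toℕ a' then a else a'

-- Position of partial composition: ∘₁ (false) or ∘₂ (true)
Pos : Set
Pos = Bool

-- Basis of Free(G)(3): trees  x ∘ᵢ y  with x, y generators
Tree3 : ℕ → Set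
Tree3 γ = Pos × Gen γ × Gen γ

module FreeOperad {c ℓ} (K : CharZeroField c ℓ) (γ : ℕ) where
  open CharZeroField K

  -- Free(G)(2) and Free(G)(3), as K-linear combinations of basis elements
  Free2 : Set c
  Free2 = Gen γ → Carrier

  Free3 : Set c
  Free3 = Tree3 γ → Carrier

  gen : Gen γ → Free2
  gen (s , a) (s' , a') with s Data.Bool.≟ s' | a Data.Fin.≟ a'
  ... | Relation.Nullary.yes _ | Relation.Nullary.yes _ = 1#
  ... | _ | _ = 0#

  tree : Tree3 γ → Free3
  tree (i , x , y) (i' , x' , y') with i Data.Bool.≟ i'
  ... | Relation.Nullary.yes _ = gen x x' * gen y y'
  ... | Relation.Nullary.no _  = 0#

  _+₂_ : Free2 → Free2 → Free2
  (u +₂ v) g = u g + v g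

  _+₃_ : Free3 → Free3 → Free3
  (u +₃ v) t = u t + v t

  _-₃_ : Free3 → Free3 → Free3
  (u -₃ v) t = u t - v t

  _·₃_ : Carrier → Free3 → Free3
  (k ·₃ v) t = k * v t

  zero₃ : Free3
  zero₃ _ = 0#

  _∘₁_ : Free2 → Free2 → Free3
  (u ∘₁ v) (false , x , y) = u x * v y
  (u ∘₁ v) (true  , x , y) = 0#

  _∘₂_ : Free2 → Free2 → Free3
  (u ∘₂ v) (false , x , y) = 0#
  (u ∘₂ v) (true  , x , y) = u x * v y

  RelIdx : Set
  RelIdx = Fin 3 × Fin γ × Fin γ

  rel : RelIdx → Free3
  rel (Fin.zero , a , a') =
    (gen (≺ a) ∘₁ gen (≻ a')) -₃ (gen (≻ a') ∘₂ gen (≺ a))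
  rel (Fin.suc Fin.zero , a , a') =
    ((gen (≺ a) ∘₁ gen (≺ a')) -₃ (gen (≺ (a ↓ a')) ∘₂ gen (≺ a)))
      -₃ (gen (≺ (a ↓ a')) ∘₂ gen (≻ a'))
  rel (Fin.suc (Fin.suc Fin.zero) , a , a') =
    ((gen (≻ (a ↓ a')) ∘₁ gen (≺ a')) +₃ (gen (≻ (a ↓ a')) ∘₁ gen (≻ a)))
      -₃ (gen (≻ a) ∘₂ gen (≻ a'))

  combo : List (Carrier × RelIdx) → Free3
  combo []             = zero₃
  combo ((k , r) ∷ cs) = (k ·₃ rel r) +₃ combo cs

  -- ⟨R⟩(3): the arity-3 component of the operad ideal generated by R
  -- (R ⊆ Free(G)(3), so this is the linear span of R)
  InIdeal3 : Free3 → Set (c ⊔ ℓ)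
  InIdeal3 v = ∃ λ (cs : List (Carrier × RelIdx)) → ∀ t → v t ≈ combo cs t

  -- equality in Dendr_γ(3) = Free(G)(3) / ⟨R⟩(3), i.e. π u = π v
  _≈D_ : Free3 → Free3 → Set (c ⊔ ℓ)
  u ≈D v = InIdeal3 (u -₃ v)

  -- ⊙_b = ≺_b + ≻_b  (a preimage under π of the element ⊙_b of Dendr_γ(2))
  ⊙ : Fin γ → Free2
  ⊙ b = gen (≺ b) +₂ gen (≻ b)

-- Summing the three dendriform relations at a = a' = b, where b ↓ b = b, every one of the
-- eight trees x ∘ᵢ y with x, y ∈ {≺_b, ≻_b} occurs exactly once, with sign + for i = 1 and
-- − for i = 2. By bilinearity of ∘₁ and ∘₂ this sum is ⊙_b ∘₁ ⊙_b − ⊙_b ∘₂ ⊙_b, which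
-- therefore lies in the span of the relations.
module Submission where

open import Defs
open import Data.Nat using (ℕ; _≤ᵇ_)
open import Data.Fin using (Fin; zero; suc; toℕ)
open import Data.Bool using (true; false)
open import Data.Product using (_,_)
open import Data.List using (List; []; _∷_; map)
open import Data.Maybe using (nothing)
open import Relation.Binary.PropositionalEquality as ≡ using (_≡_)
open import Algebra.Bundles using (CommutativeRing)
open import Tactic.RingSolver.Core.AlmostCommutativeRing using (fromCommutativeRing)

↓-idem : ∀ {γ} (a : Fin γ) → a ↓ a ≡ a
↓-idem a with toℕ a ≤ᵇ toℕ a
... | true  = ≡.refl
... | false = ≡.refl

module CommutativeRingLemmas {c ℓ} (R : CommutativeRing c ℓ) where

  open CommutativeRing R
  open import Algebra.Properties.Ring ring using (-0#≈0#)
  open import Tactic.RingSolver.NonReflective (fromCommutativeRing R (λ _ → nothing))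
    using (solve; _⊜_; _⊕_; _⊗_; ⊝_)

  x-0#≈x : ∀ x → x - 0# ≈ x
  x-0#≈x x = trans (+-congˡ -0#≈0#) (+-identityʳ x)

  *-expand : ∀ p q r s → (p + q) * (r + s) ≈ p * s + (p * r + (q * r + q * s))
  *-expand = solve 4 (λ p q r s →
    ((p ⊕ q) ⊗ (r ⊕ s)) ⊜ ((p ⊗ s) ⊕ ((p ⊗ r) ⊕ ((q ⊗ r) ⊕ (q ⊗ s))))) refl

  -‿*-expand : ∀ p q r s →
    - ((p + q) * (r + s)) ≈ - (q * r) + ((- (p * r) - p * s) + - (q * s))
  -‿*-expand = solve 4 (λ p q r s →
    (⊝ ((p ⊕ q) ⊗ (r ⊕ s))) ⊜ ((⊝ (q ⊗ r)) ⊕ (((⊝ (p ⊗ r)) ⊕ (⊝ (p ⊗ s))) ⊕ (⊝ (q ⊗ s))))) refl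

module Dendriform {c ℓ} (K : CharZeroField c ℓ) (γ : ℕ) where

  open CharZeroField K hiding (zero)
  open FreeOperad K γ
  open CommutativeRingLemmas commutativeRing
  open import Relation.Binary.Reasoning.Setoid setoid

  infix 4 _≐_

  _≐_ : Free3 → Free3 → Set ℓ
  u ≐ v = ∀ t → u t ≈ v t

  InIdeal3-respˡ : ∀ {u v} → u ≐ v → InIdeal3 v → InIdeal3 u
  InIdeal3-respˡ u≐v (cs , v≐combo) = cs , λ t → trans (u≐v t) (v≐combo t)

  relationSum : List RelIdx → Free3
  relationSum []       = zero₃
  relationSum (r ∷ rs) = rel r +₃ relationSum rs

  relationSum-∈-ideal : ∀ rs → InIdeal3 (relationSum rs)
  relationSum-∈-ideal rs = map (1# ,_) rs , sum≐combo rs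
    where
    sum≐combo : ∀ rs → relationSum rs ≐ combo (map (1# ,_) rs)
    sum≐combo []       t = refl
    sum≐combo (r ∷ rs) t = +-cong (sym (*-identityˡ (rel r t))) (sum≐combo rs t)

  associativityRelations : Fin γ → List RelIdx
  associativityRelations b =
    (zero , b , b) ∷ (suc zero , b , b) ∷ (suc (suc zero) , b , b) ∷ []

  -- The padding 0# comes from ∘₁ vanishing on ∘₂-trees and vice versa.
  associator≐associativityRelations : ∀ b →
    (⊙ b ∘₁ ⊙ b) -₃ (⊙ b ∘₂ ⊙ b) ≐ relationSum (associativityRelations b)
  associator≐associativityRelations b (false , x , y) rewrite ↓-idem b = begin
    (p + q) * (r + s) - 0#
      ≈⟨ x-0#≈x _ ⟩
    (p + q) * (r + s)
      ≈⟨ *-expand p q r s ⟩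
    p * s + (p * r + (q * r + q * s))
      ≈⟨ +-cong (x-0#≈x _)
           (+-cong (trans (x-0#≈x _) (x-0#≈x _)) (trans (+-identityʳ _) (x-0#≈x _))) ⟨
    (p * s - 0#) + (((p * r - 0#) - 0#) + (((q * r + q * s) - 0#) + 0#)) ∎
    where
    p = gen (≺ b) x
    q = gen (≻ b) x
    r = gen (≺ b) y
    s = gen (≻ b) y
  associator≐associativityRelations b (true , x , y) rewrite ↓-idem b = begin
    0# - (p + q) * (r + s)
      ≈⟨ +-identityˡ _ ⟩
    - ((p + q) * (r + s))
      ≈⟨ -‿*-expand p q r s ⟩
    - (q * r) + ((- (p * r) - p * s) + - (q * s))
      ≈⟨ +-cong (+-identityˡ _)
           (+-cong (+-congʳ (+-identityˡ _))
             (trans (+-identityʳ _) (trans (+-congʳ (+-identityˡ 0#)) (+-identityˡ _)))) ⟨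
    (0# - q * r) + (((0# - p * r) - p * s) + (((0# + 0#) - q * s) + 0#)) ∎
    where
    p = gen (≺ b) x
    q = gen (≻ b) x
    r = gen (≺ b) y
    s = gen (≻ b) y

proposition2p1p5 : ∀ {c ℓ} (K : CharZeroField c ℓ) (γ : ℕ) (b : Fin γ) →
    let open FreeOperad K γ in (⊙ b ∘₁ ⊙ b) ≈D (⊙ b ∘₂ ⊙ b)
proposition2p1p5 K γ b =
  InIdeal3-respˡ (associator≐associativityRelations b)
    (relationSum-∈-ideal (associativityRelations b))
  where open Dendriform K γ
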